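{- Let $G$ be a finite, simple, undirected, connected graph. Then ${\rm dmg}(G)=1$ if and only if ${\rm rad}(G)=2$ and there is a center $c$ of $G$ such that for every $w\in V(G)\setminus N[c]$ there exists $s\in N[c]$ that dominates $w$.
   Context: ${\rm rad}$ denotes the radius; a center is a vertex of minimum eccentricity; $N(\cdot)$ and $N[\cdot]$ are open and closed neighbourhoods. A vertex $s$ dominates a vertex $w$ if $N(w)\subseteq N[s]$. Damage game on a graph: one cop and one robber; in round $0$ the cop chooses a vertex, then the robber does; in each later round the cop moves to an adjacent vertex or passes, then the robber moves to an adjacent vertex or passes; the robber is captured if the cop occupies the robber's vertex. A vertex $v$ is damaged if the robber occupies $v$ in some round $i\ge0$ and in round $i+1$ the uncaptured robber passes or moves to a neighbour. The damage number ${\rm dmg}(\cdot)$ is the number of distinct vertices damaged when the cop plays to minimize and the robber to maximize this number. -}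

module Defs where

open import Data.Nat using (ℕ; zero; suc; _≤_)
open import Data.Fin using (Fin)
open import Data.Product using (Σ; ∃; _×_; _,_; proj₁; proj₂)
open import Data.Sum using (_⊎_)
open import Data.List using (List; []; _∷_; length)
open import Data.List.Membership.Propositional using (_∈_)
open import Relation.Nullary using (¬_; Dec)
open import Relation.Binary.PropositionalEquality using (_≡_; _≢_)

record Graph (n : ℕ) : Set₁ where
  field
    Adj     : Fin n → Fin n → Set
    adj?    : ∀ u v → Dec (Adj u v)
    sym     : ∀ {u v} → Adj u v → Adj v u
    irrefl  : ∀ {u} → ¬ Adj u u

module _ {n : ℕ} (G : Graph n) where
  open Graph G

  InClosedNbr : Fin n → Fin n → Set
  InClosedNbr u v = v ≡ u ⊎ Adj u v

  Dominates : Fin n → Fin n → Set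
  Dominates s w = ∀ x → Adj w x → InClosedNbr s x

  data Walk : Fin n → Fin n → ℕ → Set where
    here : ∀ {u} → Walk u u zero
    step : ∀ {u w v k} → Adj u w → Walk w v k → Walk u v (suc k)

  DistLe : Fin n → Fin n → ℕ → Set
  DistLe u v k = Σ ℕ λ j → j ≤ k × Walk u v j

  Connected : Set
  Connected = ∀ u v → Σ ℕ λ k → Walk u v k

  EccLe : Fin n → ℕ → Set
  EccLe v k = ∀ u → DistLe v u k

  RadIs : ℕ → Set
  RadIs r = (Σ (Fin n) λ v → EccLe v r) × (∀ v k → EccLe v k → r ≤ k)

  IsCenter : Fin n → Set
  IsCenter c = ∀ v k → EccLe v k → EccLe c k

  -- a state is (cop position , robber position) at the end of a round
  State : Set
  State = Fin n × Fin n

  Move : Fin n → Set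
  Move u = Σ (Fin n) λ v → InClosedNbr u v

  -- cop strategy: an initial vertex, and for each later round a move from
  -- its current position depending on the whole history
  -- (earlier states, most recent first, and the current state)
  record CopStrat : Set where
    field
      start : Fin n
      next  : (hist : List State) (s : State) → Move (proj₁ s)

  -- robber strategy: an initial vertex depending on the cop's initial
  -- vertex; later a move depending on the history and the cop's new position
  record RobStrat : Set where
    field
      start : Fin n → Fin n
      next  : (hist : List State) (s : State) (c' : Fin n) → Move (proj₂ s)

  run : CopStrat → RobStrat → ℕ → State × List State
  run σ τ zero = (CopStrat.start σ , RobStrat.start τ (CopStrat.start σ)) , []
  run σ τ (suc i) with run σ τ i
  ... | s , h =
    let c' = proj₁ (CopStrat.next σ h s)
        r' = proj₁ (RobStrat.next τ h s c')
    in (c' , r') , (s ∷ h)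

  copAt robAt : CopStrat → RobStrat → ℕ → Fin n
  copAt σ τ i = proj₁ (proj₁ (run σ τ i))
  robAt σ τ i = proj₂ (proj₁ (run σ τ i))

  -- v is damaged: the robber occupies v in round i, has not been captured
  -- in rounds 0..i, and is not captured by the cop's move in round i+1
  -- (so the uncaptured robber passes or moves in round i+1)
  Damaged : CopStrat → RobStrat → Fin n → Set
  Damaged σ τ v = Σ ℕ λ i →
      robAt σ τ i ≡ v
    × (∀ j → j ≤ i → copAt σ τ j ≢ robAt σ τ j)
    × copAt σ τ (suc i) ≢ v

  DmgLe : ℕ → Set
  DmgLe k = Σ CopStrat λ σ → ∀ (τ : RobStrat) →
    Σ (List (Fin n)) λ L → length L ≤ k × (∀ v → Damaged σ τ v → v ∈ L)

  -- dmg(G) = k  (dmg is the minimum k with DmgLe k)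
  DmgIs : ℕ → Set
  DmgIs zero    = DmgLe zero
  DmgIs (suc k) = DmgLe (suc k) × ¬ DmgLe k

{-# OPTIONS --safe #-}
-- If every vertex outside N[c] is dominated by some s ∈ N[c], the cop starts at c and,
-- when the robber appears at r₀ ∉ N[c], moves to the s dominating r₀; every move of the
-- robber off r₀ then lands in N[s] and is caught, so at most r₀ is damaged. Conversely, if the
-- cop starts at c and first answers a robber at w ∉ N[c] by moving to s, a robber stepping
-- from w to a neighbour x ∉ N[s] damages both w and x; hence dmg(G) = 1 forces this
-- domination property at the cop's start, which in turn gives ecc(c) ≤ 2, while
-- dmg(G) = 0 happens exactly when some vertex is adjacent to all others.
module Submission where

open import Defs
open import Data.Nat using (ℕ; zero; suc; _≤_; _<_; z≤n; s≤s)
open import Data.Nat.Properties using (≤-refl; ≤-trans; m≤n⇒m<n∨m≡n)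
open import Data.Fin using (Fin; _≟_)
open import Data.Product using (Σ; _×_; _,_; proj₁; proj₂)
open import Data.Sum using (_⊎_; inj₁; inj₂; map₂)
open import Data.List using (List; []; _∷_; [_]; length)
open import Data.List.Membership.Propositional using (_∈_)
open import Data.List.Relation.Unary.Any using (here)
open import Data.Empty using (⊥-elim)
open import Function.Base using (_∘_)
open import Function.Bundles using (_⇔_; mk⇔; Equivalence)
open import Relation.Nullary using (¬_; Dec; yes; no)
open import Relation.Nullary.Decidable using (_⊎-dec_)
open import Relation.Binary.PropositionalEquality
  using (_≡_; _≢_; refl; sym; trans; subst)

∉-length≤0 : ∀ {a} {A : Set a} {xs : List A} {x : A} → length xs ≤ 0 → ¬ x ∈ xs
∉-length≤0 {xs = []} _ ()

∈-length≤1⇒≡ : ∀ {a} {A : Set a} {xs : List A} {x y : A} →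
               length xs ≤ 1 → x ∈ xs → y ∈ xs → x ≡ y
∈-length≤1⇒≡ {xs = _ ∷ []} _ (here x≡z) (here y≡z) = trans x≡z (sym y≡z)
∈-length≤1⇒≡ {xs = _ ∷ _ ∷ _} (s≤s ())

module _ {n : ℕ} (G : Graph n) where
  open Graph G renaming (sym to adj-sym)

  inClosedNbr? : ∀ u v → Dec (InClosedNbr G u v)
  inClosedNbr? u v = (v ≟ u) ⊎-dec adj? u v

  ClosedNbrDominates : Fin n → Set
  ClosedNbrDominates c =
    ∀ w → ¬ InClosedNbr G c w → Σ (Fin n) λ s → InClosedNbr G c s × Dominates G s w

  inClosedNbr⇒distLe1 : ∀ {u v} → InClosedNbr G u v → DistLe G u v 1
  inClosedNbr⇒distLe1 (inj₁ refl) = 0 , z≤n , here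
  inClosedNbr⇒distLe1 (inj₂ uv)   = 1 , ≤-refl , step uv here

  distLe1⇒inClosedNbr : ∀ {u v} → DistLe G u v 1 → InClosedNbr G u v
  distLe1⇒inClosedNbr (zero , _ , here)             = inj₁ refl
  distLe1⇒inClosedNbr (suc zero , _ , step uv here) = inj₂ uv
  distLe1⇒inClosedNbr (suc (suc _) , s≤s () , _)

  distLe-mono : ∀ {u v k k'} → k ≤ k' → DistLe G u v k → DistLe G u v k'
  distLe-mono k≤k' (j , j≤k , walk) = j , ≤-trans j≤k k≤k' , walk

  eccLe-mono : ∀ {v k k'} → k ≤ k' → EccLe G v k → EccLe G v k'
  eccLe-mono k≤k' ecc u = distLe-mono k≤k' (ecc u)

  noDominatingVertex⇒eccLe≥2 : ¬ Σ (Fin n) (λ v → EccLe G v 1) →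
                               ∀ v k → EccLe G v k → 2 ≤ k
  noDominatingVertex⇒eccLe≥2 none v zero          ecc = ⊥-elim (none (v , eccLe-mono z≤n ecc))
  noDominatingVertex⇒eccLe≥2 none v (suc zero)    ecc = ⊥-elim (none (v , ecc))
  noDominatingVertex⇒eccLe≥2 none v (suc (suc k)) _   = s≤s (s≤s z≤n)

  closedNbrDominates⇒commonNbr : ∀ {c w x} → ClosedNbrDominates c →
    ¬ InClosedNbr G c w → Adj w x → Σ (Fin n) λ s → Adj c s × Adj s w
  closedNbrDominates⇒commonNbr {c} {w} {x} dom w∉ wx with inClosedNbr? c x
  ... | yes (inj₁ refl) = ⊥-elim (w∉ (inj₂ (adj-sym wx)))
  ... | yes (inj₂ cx)   = x , cx , adj-sym wx
  ... | no x∉ with dom x x∉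
  ...   | s , s∈ , s-dom with s-dom w (adj-sym wx) | s∈
  ...     | inj₁ refl | _         = ⊥-elim (w∉ s∈)
  ...     | inj₂ sw   | inj₁ refl = ⊥-elim (w∉ (inj₂ sw))
  ...     | inj₂ sw   | inj₂ cs   = s , cs , sw

  closedNbrDominates⇒eccLe2 : ∀ {c} → Connected G → ClosedNbrDominates c → EccLe G c 2
  closedNbrDominates⇒eccLe2 {c} conn dom w with inClosedNbr? c w
  ... | yes w∈ = distLe-mono (s≤s z≤n) (inClosedNbr⇒distLe1 w∈)
  ... | no w∉ with conn w c
  ...   | _ , here      = ⊥-elim (w∉ (inj₁ refl))
  ...   | _ , step wx _ with closedNbrDominates⇒commonNbr dom w∉ wx
  ...     | s , cs , sw = 2 , ≤-refl , step cs (step sw here)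

  module _ (σ : CopStrat G) (τ : RobStrat G) where

    cop-moves : ∀ i → InClosedNbr G (copAt G σ τ i) (copAt G σ τ (suc i))
    cop-moves i = proj₂ (CopStrat.next σ _ _)

    rob-moves : ∀ i → InClosedNbr G (robAt G σ τ i) (robAt G σ τ (suc i))
    rob-moves i = proj₂ (RobStrat.next τ _ _ _)

    outOfReach⇒damaged : ∀ i → (∀ j → j < i → copAt G σ τ j ≢ robAt G σ τ j) →
      ¬ InClosedNbr G (copAt G σ τ i) (robAt G σ τ i) → Damaged G σ τ (robAt G σ τ i)
    outOfReach⇒damaged i uncaught r∉ = i , refl , uncaught≤ , escapes
      where
      uncaught≤ : ∀ j → j ≤ i → copAt G σ τ j ≢ robAt G σ τ j
      uncaught≤ j j≤i with m≤n⇒m<n∨m≡n j≤i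
      ... | inj₁ j<i  = uncaught j j<i
      ... | inj₂ refl = λ c≡r → r∉ (inj₁ (sym c≡r))

      escapes : copAt G σ τ (suc i) ≢ robAt G σ τ i
      escapes c≡r = r∉ (subst (InClosedNbr G (copAt G σ τ i)) c≡r (cop-moves i))

    startOutside⇒damaged :
      ¬ InClosedNbr G (copAt G σ τ 0) (robAt G σ τ 0) → Damaged G σ τ (robAt G σ τ 0)
    startOutside⇒damaged = outOfReach⇒damaged 0 λ _ ()

  module Pursuit (c : Fin n) (target : Fin n → Fin n) where

    pursue : (cp rb : Fin n) → Move G cp
    pursue cp rb with inClosedNbr? cp rb | inClosedNbr? cp (target rb)
    ... | yes rb∈ | _      = rb , rb∈
    ... | no _    | yes t∈ = target rb , t∈
    ... | no _    | no _   = cp , inj₁ refl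

    pursuit : CopStrat G
    pursuit = record { start = c ; next = λ _ s → pursue (proj₁ s) (proj₂ s) }

    pursue-catches : ∀ {cp rb} → InClosedNbr G cp rb → proj₁ (pursue cp rb) ≡ rb
    pursue-catches {cp} {rb} rb∈ with inClosedNbr? cp rb | inClosedNbr? cp (target rb)
    ... | yes _  | _ = refl
    ... | no rb∉ | _ = ⊥-elim (rb∉ rb∈)

    pursue-heads : ∀ {cp rb} → ¬ InClosedNbr G cp rb → InClosedNbr G cp (target rb) →
                   proj₁ (pursue cp rb) ≡ target rb
    pursue-heads {cp} {rb} rb∉ t∈ with inClosedNbr? cp rb | inClosedNbr? cp (target rb)
    ... | yes rb∈ | _      = ⊥-elim (rb∉ rb∈)
    ... | no _    | yes _  = refl
    ... | no _    | no t∉  = ⊥-elim (t∉ t∈)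

    pursue-catches-or-heads : ∀ {cp rb} → InClosedNbr G cp (target rb) →
      proj₁ (pursue cp rb) ≡ rb ⊎ proj₁ (pursue cp rb) ≡ target rb
    pursue-catches-or-heads {cp} {rb} t∈ with inClosedNbr? cp rb | inClosedNbr? cp (target rb)
    ... | yes _ | _      = inj₁ refl
    ... | no _  | yes _  = inj₂ refl
    ... | no _  | no t∉  = ⊥-elim (t∉ t∈)

    pursue-guards : ∀ {cp r₀ rb} → cp ≡ target r₀ → Dominates G cp r₀ → InClosedNbr G r₀ rb →
      proj₁ (pursue cp rb) ≡ rb ⊎ (rb ≡ r₀ × proj₁ (pursue cp rb) ≡ target r₀)
    pursue-guards {rb = rb} _    cp-dom (inj₂ r₀~rb) = inj₁ (pursue-catches (cp-dom rb r₀~rb))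
    pursue-guards {cp}      cp≡t _      (inj₁ refl)  =
      map₂ (refl ,_) (pursue-catches-or-heads (subst (InClosedNbr G cp) cp≡t (inj₁ refl)))

    module _ (τ : RobStrat G) where

      cop rob : ℕ → Fin n
      cop = copAt G pursuit τ
      rob = robAt G pursuit τ

      Tracks : ℕ → Set
      Tracks i = cop (suc i) ≡ rob i

      tracks-suc : ∀ i → Tracks i → Tracks (suc i)
      tracks-suc i t =
        pursue-catches (subst (λ v → InClosedNbr G v (rob (suc i))) (sym t) (rob-moves pursuit τ i))

      startInside⇒tracks : InClosedNbr G c (rob 0) → ∀ i → Tracks i
      startInside⇒tracks r∈ zero    = pursue-catches r∈
      startInside⇒tracks r∈ (suc i) = tracks-suc i (startInside⇒tracks r∈ i)

      startInside⇒undamaged : InClosedNbr G c (rob 0) → ∀ v → ¬ Damaged G pursuit τ v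
      startInside⇒undamaged r∈ v (i , r≡v , _ , c≢v) = c≢v (trans (startInside⇒tracks r∈ i) r≡v)

      module _ (r₀∉ : ¬ InClosedNbr G c (rob 0))
               (t∈ : InClosedNbr G c (target (rob 0)))
               (t-dom : Dominates G (target (rob 0)) (rob 0)) where

        Guards : ℕ → Set
        Guards i = Tracks i ⊎ (rob i ≡ rob 0 × cop (suc i) ≡ target (rob 0))

        guards : ∀ i → Guards i
        guards zero    = inj₂ (refl , pursue-heads r₀∉ t∈)
        guards (suc i) with guards i
        ... | inj₁ t            = inj₁ (tracks-suc i t)
        ... | inj₂ (r≡r₀ , c≡t) = pursue-guards c≡t
          (subst (λ v → Dominates G v (rob 0)) (sym c≡t) t-dom)
          (subst (λ v → InClosedNbr G v (rob (suc i))) r≡r₀ (rob-moves pursuit τ i))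

        startOutside⇒damaged⇒start : ∀ {v} → Damaged G pursuit τ v → v ≡ rob 0
        startOutside⇒damaged⇒start (i , r≡v , _ , c≢v) with guards i
        ... | inj₁ t            = ⊥-elim (c≢v (trans t r≡v))
        ... | inj₂ (r≡r₀ , _) = trans (sym r≡v) r≡r₀

  closedNbrDominates⇒dmgLe1 : ∀ {c} → ClosedNbrDominates c → DmgLe G 1
  closedNbrDominates⇒dmgLe1 {c} dom = pursuit , λ τ → [ rob τ 0 ] , ≤-refl , damaged∈ τ
    where
    target : Fin n → Fin n
    target w with inClosedNbr? c w
    ... | yes _ = c
    ... | no w∉ = proj₁ (dom w w∉)

    target-dominates : ∀ {w} → ¬ InClosedNbr G c w →
                       InClosedNbr G c (target w) × Dominates G (target w) w
    target-dominates {w} w∉ with inClosedNbr? c w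
    ... | yes w∈ = ⊥-elim (w∉ w∈)
    ... | no w∉' = proj₂ (dom w w∉')

    open Pursuit c target

    damaged∈ : ∀ τ v → Damaged G pursuit τ v → v ∈ [ rob τ 0 ]
    damaged∈ τ v dmg with inClosedNbr? c (rob τ 0)
    ... | yes r∈ = ⊥-elim (startInside⇒undamaged τ r∈ v dmg)
    ... | no r∉  = here (startOutside⇒damaged⇒start τ r∉ t∈ t-dom dmg)
      where open Σ (target-dominates r∉) renaming (proj₁ to t∈; proj₂ to t-dom)

  stay : Fin n → RobStrat G
  stay u = record { start = λ _ → u ; next = λ _ s _ → proj₂ s , inj₁ refl }

  dmgLe0⇒startDominating : (d : DmgLe G 0) → ∀ u → InClosedNbr G (CopStrat.start (proj₁ d)) u
  dmgLe0⇒startDominating (σ , bound) u with inClosedNbr? (CopStrat.start σ) u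
  ... | yes u∈ = u∈
  ... | no u∉ with bound (stay u)
  ...   | _ , len≤0 , covers = ⊥-elim (∉-length≤0 len≤0 (covers u (startOutside⇒damaged σ (stay u) u∉)))

  dmgLe0⇔dominatingVertex : DmgLe G 0 ⇔ Σ (Fin n) (λ v → EccLe G v 1)
  dmgLe0⇔dominatingVertex = mk⇔
    (λ d → _ , inClosedNbr⇒distLe1 ∘ dmgLe0⇒startDominating d)
    (λ (v , ecc) → let open Pursuit v (λ _ → v) in
      pursuit , λ τ → [] , z≤n , λ u → ⊥-elim ∘
        startInside⇒undamaged τ (distLe1⇒inClosedNbr (ecc _)) u)

  stepAway : ∀ {w x} → Adj w x → (r : Fin n) → Move G r
  stepAway {w} {x} wx r with r ≟ w
  ... | yes r≡w = x , inj₂ (subst (λ v → Adj v x) (sym r≡w) wx)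
  ... | no _    = r , inj₁ refl

  stepAway-from : ∀ {w x} (wx : Adj w x) → proj₁ (stepAway wx w) ≡ x
  stepAway-from {w} wx with w ≟ w
  ... | yes _  = refl
  ... | no w≢w = ⊥-elim (w≢w refl)

  hop : ∀ {w x} → Adj w x → RobStrat G
  hop {w} wx = record { start = λ _ → w ; next = λ _ s _ → stepAway wx (proj₂ s) }

  dmgLe1⇒closedNbrDominates : (d : DmgLe G 1) → ClosedNbrDominates (CopStrat.start (proj₁ d))
  dmgLe1⇒closedNbrDominates (σ , bound) w w∉ = s , s∈ , s-dominates
    where
    c s : Fin n
    c = CopStrat.start σ
    s = proj₁ (CopStrat.next σ [] (c , w))

    s∈ : InClosedNbr G c s
    s∈ = proj₂ (CopStrat.next σ [] (c , w))

    s-dominates : Dominates G s w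
    s-dominates x wx with inClosedNbr? s x
    ... | yes x∈ = x∈
    ... | no x∉ = ⊥-elim (irrefl (subst (Adj w) (sym w≡x) wx))
      where
      rob₁∉ : ¬ InClosedNbr G s (robAt G σ (hop wx) 1)
      rob₁∉ = subst (λ v → ¬ InClosedNbr G s v) (sym (stepAway-from wx)) x∉

      uncaught₀ : ∀ j → j < 1 → copAt G σ (hop wx) j ≢ robAt G σ (hop wx) j
      uncaught₀ zero    _ c≡w = w∉ (inj₁ (sym c≡w))
      uncaught₀ (suc _) (s≤s ())

      w≡x : w ≡ x
      w≡x with bound (hop wx)
      ... | _ , len≤1 , covers = trans
        (∈-length≤1⇒≡ len≤1 (covers w (startOutside⇒damaged σ (hop wx) w∉))
                            (covers _ (outOfReach⇒damaged σ (hop wx) 1 uncaught₀ rob₁∉)))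
        (stepAway-from wx)

  dmgIs1⇒rad2-center : Connected G → DmgIs G 1 →
    RadIs G 2 × Σ (Fin n) λ c → IsCenter G c × ClosedNbrDominates c
  dmgIs1⇒rad2-center conn (dmg≤1 , dmg≰0) = ((c , ecc≤2) , ecc≥2) , c , center , dom
    where
    c : Fin n
    c = CopStrat.start (proj₁ dmg≤1)

    dom : ClosedNbrDominates c
    dom = dmgLe1⇒closedNbrDominates dmg≤1

    ecc≤2 : EccLe G c 2
    ecc≤2 = closedNbrDominates⇒eccLe2 conn dom

    ecc≥2 : ∀ v k → EccLe G v k → 2 ≤ k
    ecc≥2 = noDominatingVertex⇒eccLe≥2 (dmg≰0 ∘ Equivalence.from dmgLe0⇔dominatingVertex)

    center : IsCenter G c
    center v k ecc = eccLe-mono (ecc≥2 v k ecc) ecc≤2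

  rad2-center⇒dmgIs1 : RadIs G 2 × Σ (Fin n) (λ c → IsCenter G c × ClosedNbrDominates c) →
                       DmgIs G 1
  rad2-center⇒dmgIs1 ((_ , rad≥2) , _ , _ , dom) = closedNbrDominates⇒dmgLe1 dom , dmg≰0
    where
    dmg≰0 : ¬ DmgLe G 0
    dmg≰0 dmg≤0 with Equivalence.to dmgLe0⇔dominatingVertex dmg≤0
    ... | v , ecc≤1 with rad≥2 v 1 ecc≤1
    ...   | s≤s ()

theorem26 : (n : ℕ) → 0 < n → (G : Graph n) → Connected G →
    DmgIs G 1 ⇔
      (RadIs G 2 × Σ (Fin n) λ c → IsCenter G c ×
        (∀ w → ¬ InClosedNbr G c w →
          Σ (Fin n) λ s → InClosedNbr G c s × Dominates G s w))
theorem26 _ _ G conn = mk⇔ (dmgIs1⇒rad2-center G conn) (rad2-center⇒dmgIs1 G)
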